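{- Let $X$ be a finite set with $n=|X|$. If a non-empty subset $\tau$ of $\binom{X}{3}$ is phylogenetically flexible, then $|\tau|\le n-2$.
   Context: A rooted phylogenetic $X$-tree is a rooted tree with labelled leaf set $X$ whose non-leaf vertices are unlabelled with out-degree at least 2. A rooted triple $ab|c$ is the rooted binary tree on $\{a,b,c\}$ with $c$ adjacent to the root; a rooted phylogenetic tree displays $ab|c$ if it contains a subdivision of it as a subgraph. A set of rooted triples with leaves in $X$ is compatible if some rooted phylogenetic $X$-tree displays all of them. A non-empty $\tau\subseteq\binom{X}{3}$ is phylogenetically flexible if, for every choice of one rooted triple with leaf set $s$ for each $s\in\tau$, the resulting set of rooted triples is compatible. -}

module Defs where

open import Data.Nat using (ℕ)
open import Data.Fin using (Fin; zero; suc; _<_)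
open import Data.List using (List; []; _∷_; _++_; concatMap)
open import Data.List.Membership.Propositional using (_∈_; _∉_)
open import Data.List.Relation.Unary.Unique.Propositional using (Unique)
open import Data.Product using (Σ; ∃; _×_; _,_)
open import Relation.Binary.PropositionalEquality using (_≡_)

-- Rooted phylogenetic trees with leaves labelled by elements of X = Fin n.
-- An internal vertex has a list of at least two children (out-degree ≥ 2);
-- internal vertices are unlabelled.
data RTree (n : ℕ) : Set where
  leaf : Fin n → RTree n
  node : (t₁ t₂ : RTree n) → (ts : List (RTree n)) → RTree n

children : ∀ {n} → RTree n → List (RTree n)
children (leaf _) = []
children (node t₁ t₂ ts) = t₁ ∷ t₂ ∷ ts

leaves : ∀ {n} → RTree n → List (Fin n)
leavesL : ∀ {n} → List (RTree n) → List (Fin n)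
leaves (leaf x) = x ∷ []
leaves (node t₁ t₂ ts) = leaves t₁ ++ leaves t₂ ++ leavesL ts
leavesL [] = []
leavesL (t ∷ ts) = leaves t ++ leavesL ts

IsPhyloTree : ∀ {n} → RTree n → Set
IsPhyloTree {n} T = Unique (leaves T) × (∀ (x : Fin n) → x ∈ leaves T)

-- S ⊑ T : S is the subtree rooted at a descendant (or equal) vertex of T.
data _⊑_ {n : ℕ} : RTree n → RTree n → Set where
  here  : ∀ {T} → T ⊑ T
  there : ∀ {S U T} → S ⊑ U → U ∈ children T → S ⊑ T

-- Rooted triple ab|c  (c adjacent to the root).
record RootedTriple (n : ℕ) : Set where
  constructor _∣_∣_
  field
    a b c : Fin n

Displays : ∀ {n} → RTree n → RootedTriple n → Set
Displays T (a ∣ b ∣ c) =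
  ∃ λ S → S ⊑ T × a ∈ leaves S × b ∈ leaves S × c ∉ leaves S

-- A 3-element subset {a,b,c} of X, listed increasingly.
record Triple (n : ℕ) : Set where
  constructor triple
  field
    a b c : Fin n
    a<b : a < b
    b<c : b < c

rootedOn : ∀ {n} → Triple n → Fin 3 → RootedTriple n
rootedOn (triple a b c _ _) zero = b ∣ c ∣ a
rootedOn (triple a b c _ _) (suc zero) = a ∣ c ∣ b
rootedOn (triple a b c _ _) (suc (suc zero)) = a ∣ b ∣ c

Compatible : ∀ {n} → (RootedTriple n → Set) → Set
Compatible {n} R =
  ∃ λ (T : RTree n) → IsPhyloTree T × (∀ r → R r → Displays T r)

PhyloFlexible : ∀ {n} → List (Triple n) → Set
PhyloFlexible {n} τ =
  ∀ (choice : Triple n → Fin 3) →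
    Compatible (λ r → ∃ λ s → s ∈ τ × r ≡ rootedOn s (choice s))

{-# OPTIONS --safe #-}
-- Suppose |τ| ≥ n - 1 and read τ as a family of 3-sets. The whole family covers at most |τ| + 1
-- points, so some minimal nonempty subfamily M covers at most |M| + 1 points; minimality makes M a
-- hyperforest (every nonempty subfamily M′ covers at least |M′| + 1 points) covering exactly
-- |M| + 1 points. By Lovász's shrinking argument every member of M can be cut down to a pair while
-- keeping the hyperforest condition, and then the pairs connect the covered set W. Choose for each
-- member of M the rooted triple whose cherry is its pair. In a tree displaying all of them, the
-- lowest vertex whose leaves contain W distributes W over several children, so some pair is split
-- between two children; but the cherry of a displayed triple lies within one child, because its
-- outgroup lies in W.
module Submission where

open import Defs hiding (_∣_∣_)

open import Data.Empty using (⊥; ⊥-elim)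
open import Data.Fin.Base using (Fin; zero; suc)
import Data.Fin.Properties as Fin
open import Data.Fin.Subset renaming (⊥ to ∅)
open import Data.Fin.Subset.Properties
open import Data.List.Base using (List; []; _∷_; _++_; length; lookup)
open import Data.List.Membership.Propositional using (find; lose) renaming (_∈_ to _∈ₗ_; _∉_ to _∉ₗ_)
open import Data.List.Membership.Propositional.Properties using (∈-++⁺ˡ; ∈-++⁺ʳ; ∈-lookup)
open import Data.List.Relation.Unary.All using (All; []; _∷_)
import Data.List.Relation.Unary.All as All
import Data.List.Relation.Unary.All.Properties as All
open import Data.List.Relation.Unary.AllPairs using ([]; _∷_)
open import Data.List.Relation.Unary.Any using (here; there; any?)
import Data.List.Relation.Unary.Any as Any
open import Data.List.Relation.Unary.Unique.Propositional using (Unique)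
open import Data.Nat.Base using (ℕ; zero; suc; _+_; _∸_; _≤_; _<_; z≤n; s≤s)
open import Data.Nat.Induction using (<-wellFounded)
open import Data.Nat.Properties
  using ( _≤?_; module ≤-Reasoning; ≤-trans; ≤-reflexive; ≤-pred; <⇒≱; ≰⇒>; ≮⇒≥; n≤1+n; n≤0⇒n≡0
        ; +-suc; +-identityʳ; +-mono-≤; +-mono-<-≤; +-mono-≤-<; +-monoˡ-≤; m≤n+m∸n )
open import Data.Product using (∃; ∃₂; _×_; _,_; proj₁; proj₂)
open import Data.Sum using (_⊎_; inj₁; inj₂; [_,_]′)
open import Data.Vec.Base using ([]; _∷_; here; there; tabulate)
open import Data.Vec.Functional using (updateAt)
open import Data.Vec.Functional.Properties using (updateAt-updates; updateAt-minimal)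
open import Data.Vec.Properties using (lookup∘tabulate; []=⇒lookup; lookup⇒[]=)
open import Function.Base using (_∘_; id)
open import Induction.WellFounded using (Acc; acc)
open import Relation.Binary.Definitions using (DecidableEquality)
open import Relation.Binary.PropositionalEquality
  using (_≡_; _≢_; refl; sym; trans; cong; cong₂; subst; ≢-sym; module ≡-Reasoning)
open import Relation.Nullary using (¬_; yes; no; Dec; does)
open import Relation.Nullary.Decidable using (dec-true; decidable-stable; ¬¬-excluded-middle; _×-dec_; ¬?)
open import Relation.Unary using (Pred; Decidable)

-- Finite sets

private variable
  n : ℕ
  p q : Subset n
  x y : Fin n

∣p∪q∣+∣p∩q∣≡∣p∣+∣q∣ : ∀ (p q : Subset n) → ∣ p ∪ q ∣ + ∣ p ∩ q ∣ ≡ ∣ p ∣ + ∣ q ∣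
∣p∪q∣+∣p∩q∣≡∣p∣+∣q∣ []            []            = refl
∣p∪q∣+∣p∩q∣≡∣p∣+∣q∣ (outside ∷ p) (outside ∷ q) = ∣p∪q∣+∣p∩q∣≡∣p∣+∣q∣ p q
∣p∪q∣+∣p∩q∣≡∣p∣+∣q∣ (outside ∷ p) (inside  ∷ q) =
  trans (cong suc (∣p∪q∣+∣p∩q∣≡∣p∣+∣q∣ p q)) (sym (+-suc ∣ p ∣ ∣ q ∣))
∣p∪q∣+∣p∩q∣≡∣p∣+∣q∣ (inside  ∷ p) (outside ∷ q) = cong suc (∣p∪q∣+∣p∩q∣≡∣p∣+∣q∣ p q)
∣p∪q∣+∣p∩q∣≡∣p∣+∣q∣ (inside  ∷ p) (inside  ∷ q) =
  cong suc (trans (+-suc ∣ p ∪ q ∣ ∣ p ∩ q ∣)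
                  (trans (cong suc (∣p∪q∣+∣p∩q∣≡∣p∣+∣q∣ p q)) (sym (+-suc ∣ p ∣ ∣ q ∣))))

∣p∩q∣+∣p∩∁q∣≡∣p∣ : ∀ (p q : Subset n) → ∣ p ∩ q ∣ + ∣ p ∩ ∁ q ∣ ≡ ∣ p ∣
∣p∩q∣+∣p∩∁q∣≡∣p∣ []            []            = refl
∣p∩q∣+∣p∩∁q∣≡∣p∣ (inside  ∷ p) (inside  ∷ q) = cong suc (∣p∩q∣+∣p∩∁q∣≡∣p∣ p q)
∣p∩q∣+∣p∩∁q∣≡∣p∣ (inside  ∷ p) (outside ∷ q) =
  trans (+-suc ∣ p ∩ q ∣ ∣ p ∩ ∁ q ∣) (cong suc (∣p∩q∣+∣p∩∁q∣≡∣p∣ p q))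
∣p∩q∣+∣p∩∁q∣≡∣p∣ (outside ∷ p) (inside  ∷ q) = ∣p∩q∣+∣p∩∁q∣≡∣p∣ p q
∣p∩q∣+∣p∩∁q∣≡∣p∣ (outside ∷ p) (outside ∷ q) = ∣p∩q∣+∣p∩∁q∣≡∣p∣ p q

x∉p-x : ∀ (p : Subset n) x → x ∉ p - x
x∉p-x (_ ∷ p) (suc x) (there x∈p-x) = x∉p-x p x x∈p-x

x∈p-y⇒x≢y : x ∈ p - y → x ≢ y
x∈p-y⇒x≢y {p = p} {y = y} x∈p-y refl = x∉p-x p y x∈p-y

p-x⊆p : ∀ (p : Subset n) x → p - x ⊆ p
p-x⊆p p x = p─q⊆p p ⁅ x ⁆

x∈p⇒∣p∣≡1+∣p-x∣ : x ∈ p → ∣ p ∣ ≡ suc ∣ p - x ∣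
x∈p⇒∣p∣≡1+∣p-x∣ {p = inside  ∷ p} here          = cong (suc ∘ ∣_∣) (sym (p─⊥≡p p))
x∈p⇒∣p∣≡1+∣p-x∣ {p = inside  ∷ p} (there x∈p) = cong suc (x∈p⇒∣p∣≡1+∣p-x∣ x∈p)
x∈p⇒∣p∣≡1+∣p-x∣ {p = outside ∷ p} (there x∈p) = x∈p⇒∣p∣≡1+∣p-x∣ x∈p

0<∣p∣⇒Nonempty : 0 < ∣ p ∣ → Nonempty p
0<∣p∣⇒Nonempty {p = inside  ∷ p} _     = zero , here
0<∣p∣⇒Nonempty {p = outside ∷ p} 0<∣p∣ with 0<∣p∣⇒Nonempty 0<∣p∣
... | x , x∈p = suc x , there x∈p

x∈p⇒0<∣p∣ : x ∈ p → 0 < ∣ p ∣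
x∈p⇒0<∣p∣ x∈p = ≤-trans (s≤s z≤n) (≤-reflexive (sym (x∈p⇒∣p∣≡1+∣p-x∣ x∈p)))

x∈p⇒∣p-x∣≥∣p∣-1 : ∀ {m} → x ∈ p → suc m ≤ ∣ p ∣ → m ≤ ∣ p - x ∣
x∈p⇒∣p-x∣≥∣p∣-1 {m = m} x∈p m<∣p∣ = ≤-pred (subst (suc m ≤_) (x∈p⇒∣p∣≡1+∣p-x∣ x∈p) m<∣p∣)

two-elements : x ∈ p → y ∈ p - x → 2 ≤ ∣ p ∣
two-elements x∈p y∈p-x = ≤-trans (s≤s (x∈p⇒0<∣p∣ y∈p-x)) (≤-reflexive (sym (x∈p⇒∣p∣≡1+∣p-x∣ x∈p)))

three-elements : ∀ {z} → x ∈ p → y ∈ p - x → z ∈ p - x - y → 3 ≤ ∣ p ∣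
three-elements x∈p y∈p-x z∈p-x-y =
  ≤-trans (s≤s (two-elements y∈p-x z∈p-x-y)) (≤-reflexive (sym (x∈p⇒∣p∣≡1+∣p-x∣ x∈p)))

3≤∣p∣⇒three-elements : 3 ≤ ∣ p ∣ → ∃₂ λ x y → ∃ λ z → x ∈ p × y ∈ p - x × z ∈ p - x - y
3≤∣p∣⇒three-elements 3≤∣p∣
  with x , x∈p ← 0<∣p∣⇒Nonempty (≤-trans (s≤s z≤n) 3≤∣p∣)
  with y , y∈p-x ← 0<∣p∣⇒Nonempty (≤-trans (s≤s z≤n) (x∈p⇒∣p-x∣≥∣p∣-1 x∈p 3≤∣p∣))
  with z , z∈p-x-y ← 0<∣p∣⇒Nonempty (x∈p⇒∣p-x∣≥∣p∣-1 y∈p-x (x∈p⇒∣p-x∣≥∣p∣-1 x∈p 3≤∣p∣))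
  = x , y , z , x∈p , y∈p-x , z∈p-x-y

Empty⇒∣p∣≡0 : Empty p → ∣ p ∣ ≡ 0
Empty⇒∣p∣≡0 p-empty = n≤0⇒n≡0 (≮⇒≥ (p-empty ∘ 0<∣p∣⇒Nonempty))

p⊈q⇒∃∉ : ¬ p ⊆ q → ∃ λ x → x ∈ p × x ∉ q
p⊈q⇒∃∉ {p = p} {q = q} p⊈q with Fin.any? (λ x → x ∈? p ×-dec ¬? (x ∈? q))
... | yes counterexample = counterexample
... | no  ¬counterexample =
  ⊥-elim (p⊈q λ {x} x∈p → decidable-stable (x ∈? q) λ x∉q → ¬counterexample (x , x∈p , x∉q))

p⊆q∧∣q∣≤∣p∣⇒q⊆p : p ⊆ q → ∣ q ∣ ≤ ∣ p ∣ → q ⊆ p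
p⊆q∧∣q∣≤∣p∣⇒q⊆p {p = p} p⊆q ∣q∣≤∣p∣ {x} x∈q with x ∈? p
... | yes x∈p = x∈p
... | no  x∉p = ⊥-elim (<⇒≱ (p⊂q⇒∣p∣<∣q∣ (p⊆q , x , x∈q , x∉p)) ∣q∣≤∣p∣)

module _ {ℓ} {P : Pred (Fin n) ℓ} (P? : Decidable P) where

  subsetOf : Subset n
  subsetOf = tabulate (does ∘ P?)

  ∈-subsetOf⁺ : P x → x ∈ subsetOf
  ∈-subsetOf⁺ {x} px = lookup⇒[]= x subsetOf (trans (lookup∘tabulate (does ∘ P?) x) (dec-true (P? x) px))

  ∈-subsetOf⁻ : x ∈ subsetOf → P x
  ∈-subsetOf⁻ {x} x∈ with P? x | trans (sym (lookup∘tabulate (does ∘ P?) x)) ([]=⇒lookup x∈)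
  ... | yes px | _ = px

private variable
  k : ℕ
  A B M M′ : Subset k
  E F : Fin k → Subset n
  i j : Fin k

-- Unions of indexed families and hyperforests

-- Opaque, so that unification can recover A and E from ⋃[ A ] E (similarly for the opaque blocks below).
opaque
  ⋃[_]_ : Subset k → (Fin k → Subset n) → Subset n
  ⋃[ []          ] E = ∅
  ⋃[ inside  ∷ A ] E = E zero ∪ ⋃[ A ] (E ∘ suc)
  ⋃[ outside ∷ A ] E = ⋃[ A ] (E ∘ suc)

  ∈-⋃⁺ : i ∈ A → x ∈ E i → x ∈ ⋃[ A ] E
  ∈-⋃⁺ {A = inside  ∷ A} here        x∈E = x∈p∪q⁺ (inj₁ x∈E)
  ∈-⋃⁺ {A = inside  ∷ A} (there i∈A) x∈E = x∈p∪q⁺ (inj₂ (∈-⋃⁺ i∈A x∈E))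
  ∈-⋃⁺ {A = outside ∷ A} (there i∈A) x∈E = ∈-⋃⁺ i∈A x∈E

  ∈-⋃⁻ : ∀ A → x ∈ ⋃[ A ] E → ∃ λ i → i ∈ A × x ∈ E i
  ∈-⋃⁻ [] x∈⋃ = ⊥-elim (∉⊥ x∈⋃)
  ∈-⋃⁻ {E = E} (inside ∷ A) x∈⋃ with x∈p∪q⁻ (E zero) (⋃[ A ] (E ∘ suc)) x∈⋃
  ... | inj₁ x∈E = zero , here , x∈E
  ... | inj₂ x∈⋃′ with ∈-⋃⁻ A x∈⋃′
  ...   | i , i∈A , x∈E = suc i , there i∈A , x∈E
  ∈-⋃⁻ (outside ∷ A) x∈⋃ with ∈-⋃⁻ A x∈⋃
  ... | i , i∈A , x∈E = suc i , there i∈A , x∈E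

⋃-mono : A ⊆ B → (∀ {i} → i ∈ A → E i ⊆ F i) → ⋃[ A ] E ⊆ ⋃[ B ] F
⋃-mono {A = A} A⊆B E⊆F x∈⋃ with ∈-⋃⁻ A x∈⋃
... | i , i∈A , x∈E = ∈-⋃⁺ (A⊆B i∈A) (E⊆F i∈A x∈E)

⋃-monoˡ : ∀ (E : Fin k → Subset n) → A ⊆ B → ⋃[ A ] E ⊆ ⋃[ B ] E
⋃-monoˡ E A⊆B = ⋃-mono A⊆B (λ _ → id)

Hyperforest : (Fin k → Subset n) → Subset k → Set
Hyperforest E A = ∀ {M} → M ⊆ A → Nonempty M → suc ∣ M ∣ ≤ ∣ ⋃[ M ] E ∣

Tight : (Fin k → Subset n) → Subset k → Set
Tight E A = ∣ ⋃[ A ] E ∣ ≤ suc ∣ A ∣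

-- The theorem is proved by contradiction, so classical choices are made under ¬ ¬.
¬¬-minimal : ∀ {a p} {X : Set a} (P : X → Set p) (size : X → ℕ) {x : X} → P x →
             ¬ ¬ ∃ λ y → P y × (∀ {z} → P z → size y ≤ size z)
¬¬-minimal P size {x} px = go x (<-wellFounded (size x)) px
  where
  go : ∀ x → Acc _<_ (size x) → P x → ¬ ¬ ∃ λ y → P y × (∀ {z} → P z → size y ≤ size z)
  go x (acc smaller) px no-minimum = ¬¬-excluded-middle {A = ∃ λ z → P z × size z < size x} λ where
    (yes (z , pz , z<x)) → go z (smaller z<x) pz no-minimum
    (no  ¬z<x)           → no-minimum (x , px , λ pz → ≮⇒≥ (λ z<x → ¬z<x (_ , pz , z<x)))

module _ (E : Fin k → Subset n) (∣E∣≥2 : ∀ i → 2 ≤ ∣ E i ∣) (M-nonempty : Nonempty M)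
         (M-minimal : ∀ {M′} → M′ ⊆ M → Nonempty M′ → Tight E M′ → ∣ M ∣ ≤ ∣ M′ ∣) where

  private
    smaller-not-tight : M′ ⊆ M → Nonempty M′ → ∣ M′ ∣ < ∣ M ∣ → 2 + ∣ M′ ∣ ≤ ∣ ⋃[ M′ ] E ∣
    smaller-not-tight M′⊆M M′-nonempty ∣M′∣<∣M∣ =
      ≰⇒> λ M′-tight → <⇒≱ ∣M′∣<∣M∣ (M-minimal M′⊆M M′-nonempty M′-tight)

    M-covers : suc ∣ M ∣ ≤ ∣ ⋃[ M ] E ∣
    M-covers = covers (proj₂ M-nonempty)
      where
      covers : i ∈ M → suc ∣ M ∣ ≤ ∣ ⋃[ M ] E ∣
      covers {i} i∈M with nonempty? (M - i)
      ... | yes M-i-nonempty = begin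
        suc ∣ M ∣             ≡⟨ cong suc (x∈p⇒∣p∣≡1+∣p-x∣ i∈M) ⟩
        2 + ∣ M - i ∣         ≤⟨ smaller-not-tight (p-x⊆p M i) M-i-nonempty (x∈p⇒∣p-x∣<∣p∣ i∈M) ⟩
        ∣ ⋃[ M - i ] E ∣      ≤⟨ p⊆q⇒∣p∣≤∣q∣ (⋃-monoˡ E (p-x⊆p M i)) ⟩
        ∣ ⋃[ M ] E ∣          ∎
        where open ≤-Reasoning
      ... | no  M-i-empty = begin
        suc ∣ M ∣             ≡⟨ cong suc (trans (x∈p⇒∣p∣≡1+∣p-x∣ i∈M) (cong suc (Empty⇒∣p∣≡0 M-i-empty))) ⟩
        2                     ≤⟨ ∣E∣≥2 i ⟩
        ∣ E i ∣               ≤⟨ p⊆q⇒∣p∣≤∣q∣ (∈-⋃⁺ i∈M) ⟩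
        ∣ ⋃[ M ] E ∣          ∎
        where open ≤-Reasoning

  minimal-tight⇒hyperforest : Hyperforest E M
  minimal-tight⇒hyperforest {M′} M′⊆M M′-nonempty with ∣ M ∣ ≤? ∣ M′ ∣
  ... | no  ∣M∣≰∣M′∣ = ≤-trans (n≤1+n _) (smaller-not-tight M′⊆M M′-nonempty (≰⇒> ∣M∣≰∣M′∣))
  ... | yes ∣M∣≤∣M′∣ = begin
    suc ∣ M′ ∣        ≤⟨ s≤s (p⊆q⇒∣p∣≤∣q∣ M′⊆M) ⟩
    suc ∣ M ∣         ≤⟨ M-covers ⟩
    ∣ ⋃[ M ] E ∣      ≤⟨ p⊆q⇒∣p∣≤∣q∣ (⋃-monoˡ E (p⊆q∧∣q∣≤∣p∣⇒q⊆p M′⊆M ∣M∣≤∣M′∣)) ⟩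
    ∣ ⋃[ M′ ] E ∣     ∎
    where open ≤-Reasoning

-- Cutting hyperforests down to pairs

opaque
  _[_]-_ : (Fin k → Subset n) → Fin k → Fin n → Fin k → Subset n
  E [ i ]- v = updateAt E i (_- v)

  []-at : ∀ (E : Fin k → Subset n) i v → (E [ i ]- v) i ≡ E i - v
  []-at E i v = updateAt-updates i E

  []-elsewhere : ∀ (E : Fin k → Subset n) {i j} v → j ≢ i → (E [ i ]- v) j ≡ E j
  []-elsewhere E {i} {j} v j≢i = updateAt-minimal j i E j≢i

∈-[]-at : ∀ {E : Fin k → Subset n} {v} → x ∈ E i - v → x ∈ (E [ i ]- v) i
∈-[]-at {x = x} {i = i} {E = E} {v} = subst (x ∈_) (sym ([]-at E i v))

∈-[]-elsewhere : ∀ {E : Fin k → Subset n} {v} → j ≢ i → x ∈ E j → x ∈ (E [ i ]- v) j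
∈-[]-elsewhere {x = x} {E = E} {v} j≢i = subst (x ∈_) (sym ([]-elsewhere E v j≢i))

[]-⊆ : ∀ (E : Fin k → Subset n) i v j → (E [ i ]- v) j ⊆ E j
[]-⊆ E i v j with j Fin.≟ i
... | yes refl = subst (_⊆ E i) (sym ([]-at E i v)) (p-x⊆p (E i) v)
... | no  j≢i  = ⊆-reflexive ([]-elsewhere E v j≢i)

Violator : (Fin k → Subset n) → Subset k → Subset k → Set
Violator E A M = M ⊆ A × Nonempty M × ∣ ⋃[ M ] E ∣ ≤ ∣ M ∣

¬hyperforest⇒¬¬violator : ¬ Hyperforest E A → ¬ ¬ ∃ (Violator E A)
¬hyperforest⇒¬¬violator ¬hyperforest no-violator =
  ¬hyperforest λ {M} M⊆A M-nonempty → ≰⇒> λ small → no-violator (M , M⊆A , M-nonempty , small)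

module _ {E : Fin k → Subset n} {A : Subset k} (hyperforest : Hyperforest E A) {i : Fin k} where

  violator-contains : ∀ {v} → Violator (E [ i ]- v) A M → i ∈ M
  violator-contains {M = M} {v = v} (M⊆A , M-nonempty , small) with i ∈? M
  ... | yes i∈M = i∈M
  ... | no  i∉M = ⊥-elim (<⇒≱ (hyperforest M⊆A M-nonempty) (≤-trans (p⊆q⇒∣p∣≤∣q∣ unchanged) small))
    where
    unchanged : ⋃[ M ] E ⊆ ⋃[ M ] (E [ i ]- v)
    unchanged = ⋃-mono id λ j∈M → ∈-[]-elsewhere λ { refl → i∉M j∈M }

  -- If removing v₁ and removing v₂ from E i create violators M₁ and M₂, covering U₁ and U₂, then
  -- ∣ M₁ ∪ M₂ ∣ + ∣ M₁ ∩ M₂ ∣ = ∣ M₁ ∣ + ∣ M₂ ∣ ≥ ∣ U₁ ∣ + ∣ U₂ ∣ = ∣ U₁ ∪ U₂ ∣ + ∣ U₁ ∩ U₂ ∣, while the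
  -- hyperforest condition gives the reverse strict inequality; a third element w of E i handles the
  -- case M₁ ∩ M₂ = {i}.
  module _ {v₁ v₂ w : Fin n} (v₂∈ : v₂ ∈ E i - v₁) (w∈ : w ∈ E i - v₁ - v₂)
           {M₁ M₂ : Subset k} (V₁ : Violator (E [ i ]- v₁) A M₁) (V₂ : Violator (E [ i ]- v₂) A M₂) where

    private
      U₁ U₂ : Subset n
      U₁ = ⋃[ M₁ ] (E [ i ]- v₁)
      U₂ = ⋃[ M₂ ] (E [ i ]- v₂)

      i∈M₁ : i ∈ M₁
      i∈M₁ = violator-contains V₁

      i∈M₂ : i ∈ M₂
      i∈M₂ = violator-contains V₂

      i∈M₁∩M₂ : i ∈ M₁ ∩ M₂
      i∈M₁∩M₂ = x∈p∩q⁺ (i∈M₁ , i∈M₂)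

    union-bound : ⋃[ M₁ ∪ M₂ ] E ⊆ U₁ ∪ U₂
    union-bound {x} x∈⋃ with ∈-⋃⁻ (M₁ ∪ M₂) x∈⋃
    ... | j , j∈M₁∪M₂ , x∈Ej with j Fin.≟ i
    ...   | no j≢i = [ (λ j∈M₁ → x∈p∪q⁺ (inj₁ (∈-⋃⁺ j∈M₁ (∈-[]-elsewhere j≢i x∈Ej))))
                     , (λ j∈M₂ → x∈p∪q⁺ (inj₂ (∈-⋃⁺ j∈M₂ (∈-[]-elsewhere j≢i x∈Ej)))) ]′
                       (x∈p∪q⁻ M₁ M₂ j∈M₁∪M₂)
    ...   | yes refl with x Fin.≟ v₁
    ...     | no  x≢v₁ = x∈p∪q⁺ (inj₁ (∈-⋃⁺ i∈M₁ (∈-[]-at (x∈p∧x≢y⇒x∈p-y x∈Ej x≢v₁))))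
    ...     | yes refl = x∈p∪q⁺ (inj₂ (∈-⋃⁺ i∈M₂ (∈-[]-at (x∈p∧x≢y⇒x∈p-y x∈Ej (≢-sym (x∈p-y⇒x≢y v₂∈))))))

    intersection-bound : ∣ M₁ ∩ M₂ ∣ ≤ ∣ U₁ ∩ U₂ ∣
    intersection-bound with nonempty? (M₁ ∩ M₂ - i)
    ... | yes N-nonempty = begin
      ∣ M₁ ∩ M₂ ∣                 ≡⟨ x∈p⇒∣p∣≡1+∣p-x∣ i∈M₁∩M₂ ⟩
      suc ∣ M₁ ∩ M₂ - i ∣         ≤⟨ hyperforest N⊆A N-nonempty ⟩
      ∣ ⋃[ M₁ ∩ M₂ - i ] E ∣      ≤⟨ p⊆q⇒∣p∣≤∣q∣ N-bound ⟩
      ∣ U₁ ∩ U₂ ∣                 ∎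
      where
      open ≤-Reasoning
      N⊆A : M₁ ∩ M₂ - i ⊆ A
      N⊆A = proj₁ V₁ ∘ p∩q⊆p M₁ M₂ ∘ p-x⊆p (M₁ ∩ M₂) i
      N-bound : ⋃[ M₁ ∩ M₂ - i ] E ⊆ U₁ ∩ U₂
      N-bound x∈⋃ with ∈-⋃⁻ (M₁ ∩ M₂ - i) x∈⋃
      ... | j , j∈N , x∈Ej with x∈p∩q⁻ M₁ M₂ (p-x⊆p (M₁ ∩ M₂) i j∈N)
      ...   | j∈M₁ , j∈M₂ = x∈p∩q⁺ ( ∈-⋃⁺ j∈M₁ (∈-[]-elsewhere (x∈p-y⇒x≢y j∈N) x∈Ej)
                                  , ∈-⋃⁺ j∈M₂ (∈-[]-elsewhere (x∈p-y⇒x≢y j∈N) x∈Ej))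
    ... | no  N-empty = begin
      ∣ M₁ ∩ M₂ ∣                 ≡⟨ x∈p⇒∣p∣≡1+∣p-x∣ i∈M₁∩M₂ ⟩
      suc ∣ M₁ ∩ M₂ - i ∣         ≡⟨ cong suc (Empty⇒∣p∣≡0 N-empty) ⟩
      1                           ≤⟨ x∈p⇒0<∣p∣ (x∈p∩q⁺ (w∈U₁ , w∈U₂)) ⟩
      ∣ U₁ ∩ U₂ ∣                 ∎
      where
      open ≤-Reasoning
      w∈U₁ : w ∈ U₁
      w∈U₁ = ∈-⋃⁺ i∈M₁ (∈-[]-at (p-x⊆p (E i - v₁) v₂ w∈))
      w∈U₂ : w ∈ U₂
      w∈U₂ = ∈-⋃⁺ i∈M₂ (∈-[]-at (x∈p∧x≢y⇒x∈p-y (p-x⊆p (E i) v₁ (p-x⊆p (E i - v₁) v₂ w∈))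
                                                (x∈p-y⇒x≢y w∈)))

    no-two-violators : ⊥
    no-two-violators = <⇒≱ violators-cover-more (+-mono-≤ (proj₂ (proj₂ V₁)) (proj₂ (proj₂ V₂)))
      where
      open ≤-Reasoning
      M₁∪M₂⊆A : M₁ ∪ M₂ ⊆ A
      M₁∪M₂⊆A = [ proj₁ V₁ , proj₁ V₂ ]′ ∘ x∈p∪q⁻ M₁ M₂
      violators-cover-more : ∣ M₁ ∣ + ∣ M₂ ∣ < ∣ U₁ ∣ + ∣ U₂ ∣
      violators-cover-more = begin-strict
        ∣ M₁ ∣ + ∣ M₂ ∣                  ≡⟨ sym (∣p∪q∣+∣p∩q∣≡∣p∣+∣q∣ M₁ M₂) ⟩
        ∣ M₁ ∪ M₂ ∣ + ∣ M₁ ∩ M₂ ∣        <⟨ +-mono-<-≤ (hyperforest M₁∪M₂⊆A (i , x∈p∪q⁺ (inj₁ i∈M₁)))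
                                                      intersection-bound ⟩
        ∣ ⋃[ M₁ ∪ M₂ ] E ∣ + ∣ U₁ ∩ U₂ ∣ ≤⟨ +-monoˡ-≤ ∣ U₁ ∩ U₂ ∣ (p⊆q⇒∣p∣≤∣q∣ union-bound) ⟩
        ∣ U₁ ∪ U₂ ∣ + ∣ U₁ ∩ U₂ ∣        ≡⟨ ∣p∪q∣+∣p∩q∣≡∣p∣+∣q∣ U₁ U₂ ⟩
        ∣ U₁ ∣ + ∣ U₂ ∣                  ∎

hyperforest-remove : Hyperforest E A → 3 ≤ ∣ E i ∣ → ¬ ¬ ∃ λ v → v ∈ E i × Hyperforest (E [ i ]- v) A
hyperforest-remove {E = E} {i = i} hyperforest 3≤∣Ei∣ no-removable
  with v₁ , v₂ , w , v₁∈ , v₂∈ , w∈ ← 3≤∣p∣⇒three-elements 3≤∣Ei∣ =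
  ¬hyperforest⇒¬¬violator (λ hf₁ → no-removable (v₁ , v₁∈ , hf₁)) λ (_ , V₁) →
  ¬hyperforest⇒¬¬violator (λ hf₂ → no-removable (v₂ , p-x⊆p (E i) v₁ v₂∈ , hf₂)) λ (_ , V₂) →
  no-two-violators hyperforest v₂∈ w∈ V₁ V₂

totalSize : (Fin k → Subset n) → ℕ
totalSize {k = zero}  E = 0
totalSize {k = suc k} E = ∣ E zero ∣ + totalSize (E ∘ suc)

totalSize-mono-≤ : ∀ {k} {F E : Fin k → Subset n} → (∀ j → ∣ F j ∣ ≤ ∣ E j ∣) → totalSize F ≤ totalSize E
totalSize-mono-≤ {k = zero}  ∣F∣≤∣E∣ = z≤n
totalSize-mono-≤ {k = suc k} ∣F∣≤∣E∣ = +-mono-≤ (∣F∣≤∣E∣ zero) (totalSize-mono-≤ (∣F∣≤∣E∣ ∘ suc))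

totalSize-mono-< : ∀ {k} {F E : Fin k → Subset n} {i} → (∀ j → ∣ F j ∣ ≤ ∣ E j ∣) → ∣ F i ∣ < ∣ E i ∣ →
                   totalSize F < totalSize E
totalSize-mono-< {i = zero}  ∣F∣≤∣E∣ ∣Fi∣<∣Ei∣ = +-mono-<-≤ ∣Fi∣<∣Ei∣ (totalSize-mono-≤ (∣F∣≤∣E∣ ∘ suc))
totalSize-mono-< {i = suc i} ∣F∣≤∣E∣ ∣Fi∣<∣Ei∣ =
  +-mono-≤-< (∣F∣≤∣E∣ zero) (totalSize-mono-< (∣F∣≤∣E∣ ∘ suc) ∣Fi∣<∣Ei∣)

totalSize-[]- : ∀ (E : Fin k → Subset n) {i v} → v ∈ E i → totalSize (E [ i ]- v) < totalSize E
totalSize-[]- E {i} {v} v∈Ei = totalSize-mono-< (λ j → p⊆q⇒∣p∣≤∣q∣ ([]-⊆ E i v j))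
  (subst (_< ∣ E i ∣) (cong ∣_∣ (sym ([]-at E i v))) (x∈p⇒∣p-x∣<∣p∣ v∈Ei))

hyperforest⇒¬¬pair-hyperforest : Hyperforest E A →
  ¬ ¬ ∃ λ F → (∀ j → F j ⊆ E j) × Hyperforest F A × (∀ j → ∣ F j ∣ ≤ 2)
hyperforest⇒¬¬pair-hyperforest {E = E} = go E (<-wellFounded (totalSize E))
  where
  go : ∀ E → Acc _<_ (totalSize E) → Hyperforest E A →
       ¬ ¬ ∃ λ F → (∀ j → F j ⊆ E j) × Hyperforest F A × (∀ j → ∣ F j ∣ ≤ 2)
  go E (acc smaller) hyperforest with Fin.any? (λ j → 3 ≤? ∣ E j ∣)
  ... | no  none-large = λ found →
    found (E , (λ _ → id) , hyperforest , λ j → ≤-pred (≰⇒> (none-large ∘ (j ,_))))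
  ... | yes (j , large) = λ found →
    hyperforest-remove hyperforest large λ (v , v∈Ej , hyperforest′) →
    go (E [ j ]- v) (smaller (totalSize-[]- E v∈Ej)) hyperforest′ λ (F , F⊆ , F-hyperforest , F-pairs) →
    found (F , (λ l → ⊆-trans (F⊆ l) ([]-⊆ E j v l)) , F-hyperforest , F-pairs)

-- Connectivity

Splits : Subset n → Subset n → Set
Splits C K = ∃₂ λ u v → u ∈ K × v ∈ K × u ∈ C × v ∉ C

Connected : (Fin k → Subset n) → Subset k → Set
Connected E A = ∀ C → (∀ {i} → i ∈ A → ¬ Splits C (E i)) → ¬ Splits C (⋃[ A ] E)

-- The members meeting C and those avoiding C cover disjoint sets, so if both kinds occur the
-- hyperforest condition forces ∣ A ∣ + 2 covered points.
module _ {E : Fin k → Subset n} {A : Subset k} (C : Subset n)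
         (unsplit : ∀ {i} → i ∈ A → ¬ Splits C (E i)) where

  private
    meets? : ∀ i → Dec (Nonempty (E i ∩ C))
    meets? i = nonempty? (E i ∩ C)

    meeting : Subset k
    meeting = subsetOf meets?

    U₁ U₀ : Subset n
    U₁ = ⋃[ A ∩ meeting ] E
    U₀ = ⋃[ A ∩ ∁ meeting ] E

    U₁⊆C : U₁ ⊆ C
    U₁⊆C {x} x∈U₁ with ∈-⋃⁻ (A ∩ meeting) x∈U₁
    ... | j , j∈A∩meeting , x∈Ej with x∈p∩q⁻ A meeting j∈A∩meeting | x ∈? C
    ...   | _   , _         | yes x∈C = x∈C
    ...   | j∈A , j∈meeting | no  x∉C with u , u∈Ej∩C ← ∈-subsetOf⁻ meets? j∈meeting
      with u∈Ej , u∈C ← x∈p∩q⁻ (E j) C u∈Ej∩C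
      = ⊥-elim (unsplit j∈A (u , x , u∈Ej , x∈Ej , u∈C , x∉C))

    U₀⊆∁C : U₀ ⊆ ∁ C
    U₀⊆∁C x∈U₀ with ∈-⋃⁻ (A ∩ ∁ meeting) x∈U₀
    ... | j , j∈A∩∁meeting , x∈Ej = x∉p⇒x∈∁p λ x∈C →
      x∈∁p⇒x∉p (proj₂ (x∈p∩q⁻ A (∁ meeting) j∈A∩∁meeting)) (∈-subsetOf⁺ meets? (_ , x∈p∩q⁺ (x∈Ej , x∈C)))

    ∣U₁∪U₀∣≡∣U₁∣+∣U₀∣ : ∣ U₁ ∪ U₀ ∣ ≡ ∣ U₁ ∣ + ∣ U₀ ∣
    ∣U₁∪U₀∣≡∣U₁∣+∣U₀∣ = begin
      ∣ U₁ ∪ U₀ ∣                  ≡⟨ sym (+-identityʳ _) ⟩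
      ∣ U₁ ∪ U₀ ∣ + 0              ≡⟨ cong (∣ U₁ ∪ U₀ ∣ +_) (sym (Empty⇒∣p∣≡0 disjoint)) ⟩
      ∣ U₁ ∪ U₀ ∣ + ∣ U₁ ∩ U₀ ∣    ≡⟨ ∣p∪q∣+∣p∩q∣≡∣p∣+∣q∣ U₁ U₀ ⟩
      ∣ U₁ ∣ + ∣ U₀ ∣              ∎
      where
      open ≡-Reasoning
      disjoint : Empty (U₁ ∩ U₀)
      disjoint (x , x∈U₁∩U₀) with x∈U₁ , x∈U₀ ← x∈p∩q⁻ U₁ U₀ x∈U₁∩U₀ =
        x∈∁p⇒x∉p (U₀⊆∁C x∈U₀) (U₁⊆C x∈U₁)

    two-sided-cover : Hyperforest E A → Nonempty (A ∩ meeting) → Nonempty (A ∩ ∁ meeting) →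
                      2 + ∣ A ∣ ≤ ∣ ⋃[ A ] E ∣
    two-sided-cover hyperforest ne₁ ne₀ = begin
      2 + ∣ A ∣                                   ≡⟨ cong (2 +_) (sym (∣p∩q∣+∣p∩∁q∣≡∣p∣ A meeting)) ⟩
      2 + (∣ A ∩ meeting ∣ + ∣ A ∩ ∁ meeting ∣)   ≡⟨ cong suc (sym (+-suc _ _)) ⟩
      suc ∣ A ∩ meeting ∣ + suc ∣ A ∩ ∁ meeting ∣ ≤⟨ +-mono-≤ (hyperforest (p∩q⊆p A meeting) ne₁)
                                                             (hyperforest (p∩q⊆p A (∁ meeting)) ne₀) ⟩
      ∣ U₁ ∣ + ∣ U₀ ∣                             ≡⟨ sym ∣U₁∪U₀∣≡∣U₁∣+∣U₀∣ ⟩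
      ∣ U₁ ∪ U₀ ∣                                 ≤⟨ p⊆q⇒∣p∣≤∣q∣ U₁∪U₀⊆⋃A ⟩
      ∣ ⋃[ A ] E ∣                                ∎
      where
      open ≤-Reasoning
      U₁∪U₀⊆⋃A : U₁ ∪ U₀ ⊆ ⋃[ A ] E
      U₁∪U₀⊆⋃A = [ ⋃-monoˡ E (p∩q⊆p A meeting) , ⋃-monoˡ E (p∩q⊆p A (∁ meeting)) ]′ ∘ x∈p∪q⁻ U₁ U₀

  hypertree-union-unsplit : Hyperforest E A → Tight E A → ¬ Splits C (⋃[ A ] E)
  hypertree-union-unsplit hyperforest tight (x , y , x∈⋃ , y∈⋃ , x∈C , y∉C)
    with i , i∈A , x∈Ei ← ∈-⋃⁻ A x∈⋃
    with j , j∈A , y∈Ej ← ∈-⋃⁻ A y∈⋃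
    = <⇒≱ (two-sided-cover hyperforest (i , x∈p∩q⁺ (i∈A , i∈meeting)) (j , x∈p∩q⁺ (j∈A , j∈∁meeting))) tight
    where
    i∈meeting : i ∈ meeting
    i∈meeting = ∈-subsetOf⁺ meets? (x , x∈p∩q⁺ (x∈Ei , x∈C))
    j∈∁meeting : j ∈ ∁ meeting
    j∈∁meeting = x∉p⇒x∈∁p λ j∈meeting → y∉C (U₁⊆C (∈-⋃⁺ (x∈p∩q⁺ (j∈A , j∈meeting)) y∈Ej))

hypertree⇒connected : Hyperforest E A → Tight E A → Connected E A
hypertree⇒connected hyperforest tight C unsplit = hypertree-union-unsplit C unsplit hyperforest tight

-- Trees

Unique-++⁻ : ∀ {A : Set} (xs : List A) {ys} → Unique (xs ++ ys) →
             Unique xs × Unique ys × (∀ {x} → x ∈ₗ xs → x ∉ₗ ys)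
Unique-++⁻ []       ys!             = [] , ys! , λ ()
Unique-++⁻ (x ∷ xs) (x∉xs++ys ∷ xs++ys!) with Unique-++⁻ xs xs++ys!
... | xs! , ys! , disjoint =
  All.++⁻ˡ xs x∉xs++ys ∷ xs! , ys! , λ where
    (here refl) x∈ys → All.lookup (All.++⁻ʳ xs x∉xs++ys) x∈ys refl
    (there x∈xs)     → disjoint x∈xs

module _ {p} (P : RTree n → Set p) (step : ∀ T → (∀ {U} → U ∈ₗ children T → P U) → P T) where

  children-induction : ∀ T → P T
  children-induction* : ∀ ts → All P ts
  children-induction (leaf x)         = step (leaf x) λ ()
  children-induction (node t₁ t₂ ts) =
    step (node t₁ t₂ ts) (All.lookup (children-induction t₁ ∷ children-induction t₂ ∷ children-induction* ts))
  children-induction* []       = []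
  children-induction* (t ∷ ts) = children-induction t ∷ children-induction* ts

private variable
  S T U U′ : RTree n
  ts : List (RTree n)

opaque
  leafSet : RTree n → Subset n
  leafSet T = subsetOf (λ x → any? (x Fin.≟_) (leaves T))

  ∈-leafSet⁺ : x ∈ₗ leaves T → x ∈ leafSet T
  ∈-leafSet⁺ {T = T} = ∈-subsetOf⁺ (λ x → any? (x Fin.≟_) (leaves T))

  ∈-leafSet⁻ : x ∈ leafSet T → x ∈ₗ leaves T
  ∈-leafSet⁻ {T = T} = ∈-subsetOf⁻ (λ x → any? (x Fin.≟_) (leaves T))

∈-leavesL⁺ : U ∈ₗ ts → x ∈ₗ leaves U → x ∈ₗ leavesL ts
∈-leavesL⁺ {ts = t ∷ ts} (here refl) x∈U = ∈-++⁺ˡ x∈U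
∈-leavesL⁺ {ts = t ∷ ts} (there U∈ts) x∈U = ∈-++⁺ʳ (leaves t) (∈-leavesL⁺ U∈ts x∈U)

leavesL-disjoint : Unique (leavesL ts) → U ∈ₗ ts → U′ ∈ₗ ts → x ∈ₗ leaves U → x ∈ₗ leaves U′ → U ≡ U′
leavesL-disjoint {ts = t ∷ ts} ts! U∈ts U′∈ts x∈U x∈U′ with Unique-++⁻ (leaves t) ts! | U∈ts | U′∈ts
... | _ , _    , _        | here refl  | here refl   = refl
... | _ , _    , disjoint | here refl  | there U′∈  = ⊥-elim (disjoint x∈U (∈-leavesL⁺ U′∈ x∈U′))
... | _ , _    , disjoint | there U∈   | here refl   = ⊥-elim (disjoint x∈U′ (∈-leavesL⁺ U∈ x∈U))
... | _ , rest! , _       | there U∈   | there U′∈  = leavesL-disjoint rest! U∈ U′∈ x∈U x∈U′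

Unique-leavesL⁻ : Unique (leavesL ts) → U ∈ₗ ts → Unique (leaves U)
Unique-leavesL⁻ {ts = t ∷ ts} ts! (here refl) = proj₁ (Unique-++⁻ (leaves t) ts!)
Unique-leavesL⁻ {ts = t ∷ ts} ts! (there U∈ts) = Unique-leavesL⁻ (proj₁ (proj₂ (Unique-++⁻ (leaves t) ts!))) U∈ts

leafSet-child : U ∈ₗ children T → leafSet U ⊆ leafSet T
leafSet-child {T = node _ _ _} U∈ = ∈-leafSet⁺ ∘ ∈-leavesL⁺ U∈ ∘ ∈-leafSet⁻

⊑⇒leafSet⊆ : S ⊑ T → leafSet S ⊆ leafSet T
⊑⇒leafSet⊆ here             = id
⊑⇒leafSet⊆ (there S⊑U U∈) = leafSet-child U∈ ∘ ⊑⇒leafSet⊆ S⊑U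

children-disjoint : Unique (leaves T) → U ∈ₗ children T → U′ ∈ₗ children T →
                    x ∈ leafSet U → x ∈ leafSet U′ → U ≡ U′
children-disjoint {T = node _ _ _} T! U∈ U′∈ x∈U x∈U′ =
  leavesL-disjoint T! U∈ U′∈ (∈-leafSet⁻ x∈U) (∈-leafSet⁻ x∈U′)

Unique-child : Unique (leaves T) → U ∈ₗ children T → Unique (leaves U)
Unique-child {T = node _ _ _} = Unique-leavesL⁻

Separates : RTree n → Subset n → Fin n → Set
Separates T K c = ∃ λ S → S ⊑ T × K ⊆ leafSet S × c ∉ leafSet S

separation-below : ∀ {K c} → c ∈ leafSet T → Separates T K c → ∃ λ U → U ∈ₗ children T × Separates U K c
separation-below c∈T (S , here          , K⊆S , c∉S) = ⊥-elim (c∉S c∈T)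
separation-below c∈T (S , there S⊑U U∈ , K⊆S , c∉S) = _ , U∈ , S , S⊑U , K⊆S , c∉S

separation-descends : ∀ {K c u} → Unique (leaves T) → U ∈ₗ children T → c ∈ leafSet T →
                      u ∈ K → u ∈ leafSet U → Separates T K c → Separates U K c
separation-descends T! U∈ c∈T u∈K u∈U separation with separation-below c∈T separation
... | U′ , U′∈ , S , S⊑U′ , K⊆S , c∉S with children-disjoint T! U′∈ U∈ (⊑⇒leafSet⊆ S⊑U′ (K⊆S u∈K)) u∈U
...   | refl = S , S⊑U′ , K⊆S , c∉S

module _ {k} {K : Fin k → Subset n} {c : Fin k → Fin n} {M : Subset k}
         (connected : Connected K M) (K-nonempty : ∀ {i} → i ∈ M → Nonempty (K i))
         (c∈⋃ : ∀ {i} → i ∈ M → c i ∈ ⋃[ M ] K) where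

  private
    W : Subset n
    W = ⋃[ M ] K

    SeparatesAll : RTree n → Set
    SeparatesAll T = ∀ {i} → i ∈ M → Separates T (K i) (c i)

  -- Descend to the lowest vertex whose leaves contain W. A vertex separating K i from c i lies
  -- strictly below the current vertex, as c i ∈ W, hence inside the child containing K i; so if no
  -- child contains W, the leaf set of a child meeting W splits W but none of the K i.
  connected-not-separable : Nonempty M → ∀ T → Unique (leaves T) → W ⊆ leafSet T → ¬ SeparatesAll T
  connected-not-separable (i₀ , i₀∈M) = children-induction _ step
    where
    step : ∀ T → (∀ {U} → U ∈ₗ children T → Unique (leaves U) → W ⊆ leafSet U → ¬ SeparatesAll U) →
           Unique (leaves T) → W ⊆ leafSet T → ¬ SeparatesAll T
    step T below T! W⊆T separates with any? (λ U → W ⊆? leafSet U) (children T)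
    ... | yes W⊆child with find W⊆child
    ...   | U , U∈ , W⊆U = below U∈ (Unique-child T! U∈) W⊆U λ i∈M →
      let u , u∈K = K-nonempty i∈M in
      separation-descends T! U∈ (W⊆T (c∈⋃ i∈M)) u∈K (W⊆U (∈-⋃⁺ i∈M u∈K)) (separates i∈M)
    step T below T! W⊆T separates | no W⊈children
      with separation-below (W⊆T (c∈⋃ i₀∈M)) (separates i₀∈M) | K-nonempty i₀∈M
    ... | U₀ , U₀∈ , S , S⊑U₀ , K⊆S , _ | u , u∈K with p⊈q⇒∃∉ (W⊈children ∘ lose U₀∈)
    ...   | y , y∈W , y∉U₀ =
      connected (leafSet U₀) unsplit (u , y , ∈-⋃⁺ i₀∈M u∈K , y∈W , ⊑⇒leafSet⊆ S⊑U₀ (K⊆S u∈K) , y∉U₀)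
      where
      unsplit : ∀ {i} → i ∈ M → ¬ Splits (leafSet U₀) (K i)
      unsplit i∈M (a , b , a∈K , b∈K , a∈U₀ , b∉U₀)
        with separation-descends T! U₀∈ (W⊆T (c∈⋃ i∈M)) a∈K a∈U₀ (separates i∈M)
      ... | S′ , S′⊑U₀ , K⊆S′ , _ = b∉U₀ (⊑⇒leafSet⊆ S′⊑U₀ (K⊆S′ b∈K))

-- Rooted triples

opaque
  tripleSet : Triple n → Subset n
  tripleSet (triple a b c _ _) = ⁅ a ⁆ ∪ ⁅ b ⁆ ∪ ⁅ c ⁆

  a∈tripleSet : ∀ {s : Triple n} → Triple.a s ∈ tripleSet s
  a∈tripleSet {s = triple a b c _ _} = x∈p∪q⁺ (inj₁ (x∈⁅x⁆ a))

  b∈tripleSet : ∀ {s : Triple n} → Triple.b s ∈ tripleSet s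
  b∈tripleSet {s = triple a b c _ _} = x∈p∪q⁺ (inj₂ (x∈p∪q⁺ (inj₁ (x∈⁅x⁆ b))))

  c∈tripleSet : ∀ {s : Triple n} → Triple.c s ∈ tripleSet s
  c∈tripleSet {s = triple a b c _ _} = x∈p∪q⁺ (inj₂ (x∈p∪q⁺ (inj₂ (x∈⁅x⁆ c))))

  ∈-tripleSet⁻ : ∀ (s : Triple n) → x ∈ tripleSet s → x ≡ Triple.a s ⊎ x ≡ Triple.b s ⊎ x ≡ Triple.c s
  ∈-tripleSet⁻ (triple a b c _ _) x∈s with x∈p∪q⁻ ⁅ a ⁆ (⁅ b ⁆ ∪ ⁅ c ⁆) x∈s
  ... | inj₁ x∈a = inj₁ (x∈⁅y⁆⇒x≡y a x∈a)
  ... | inj₂ x∈bc with x∈p∪q⁻ ⁅ b ⁆ ⁅ c ⁆ x∈bc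
  ...   | inj₁ x∈b = inj₂ (inj₁ (x∈⁅y⁆⇒x≡y b x∈b))
  ...   | inj₂ x∈c = inj₂ (inj₂ (x∈⁅y⁆⇒x≡y c x∈c))

outgroup∈tripleSet : ∀ (s : Triple n) o → RootedTriple.c (rootedOn s o) ∈ tripleSet s
outgroup∈tripleSet (triple _ _ _ _ _) zero             = a∈tripleSet
outgroup∈tripleSet (triple _ _ _ _ _) (suc zero)       = b∈tripleSet
outgroup∈tripleSet (triple _ _ _ _ _) (suc (suc zero)) = c∈tripleSet

2≤∣tripleSet∣ : ∀ (s : Triple n) → 2 ≤ ∣ tripleSet s ∣
2≤∣tripleSet∣ (triple a b c a<b _) =
  two-elements a∈tripleSet (x∈p∧x≢y⇒x∈p-y b∈tripleSet (≢-sym (Fin.<⇒≢ a<b)))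

outgroup : Triple n → Subset n → Fin 3
outgroup (triple a b c _ _) K with c ∈? K | b ∈? K
... | no  _ | _     = suc (suc zero)
... | yes _ | no  _ = suc zero
... | yes _ | yes _ = zero

outgroup-avoids : ∀ (s : Triple n) {K} → K ⊆ tripleSet s → ∣ K ∣ ≤ 2 →
                  let open RootedTriple (rootedOn s (outgroup s K)) in ∀ {x} → x ∈ K → x ≡ a ⊎ x ≡ b
outgroup-avoids s@(triple a b c a<b b<c) {K} K⊆s ∣K∣≤2 {x} x∈K with c ∈? K | b ∈? K | ∈-tripleSet⁻ s (K⊆s x∈K)
... | no  c∉K | _       | inj₁ refl        = inj₁ refl
... | no  c∉K | _       | inj₂ (inj₁ refl) = inj₂ refl
... | no  c∉K | _       | inj₂ (inj₂ refl) = ⊥-elim (c∉K x∈K)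
... | yes c∈K | no  b∉K | inj₁ refl        = inj₁ refl
... | yes c∈K | no  b∉K | inj₂ (inj₁ refl) = ⊥-elim (b∉K x∈K)
... | yes c∈K | no  b∉K | inj₂ (inj₂ refl) = inj₂ refl
... | yes c∈K | yes b∈K | inj₁ refl        = ⊥-elim (<⇒≱ (three-elements x∈K b∈K-a c∈K-a-b) ∣K∣≤2)
  where
  b∈K-a = x∈p∧x≢y⇒x∈p-y b∈K (≢-sym (Fin.<⇒≢ a<b))
  c∈K-a-b = x∈p∧x≢y⇒x∈p-y (x∈p∧x≢y⇒x∈p-y c∈K (≢-sym (Fin.<⇒≢ (Fin.<-trans a<b b<c)))) (≢-sym (Fin.<⇒≢ b<c))
... | yes c∈K | yes b∈K | inj₂ (inj₁ refl) = inj₁ refl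
... | yes c∈K | yes b∈K | inj₂ (inj₂ refl) = inj₂ refl

displays⇒separates : ∀ {r : RootedTriple n} {K} →
                     (∀ {x} → x ∈ K → x ≡ RootedTriple.a r ⊎ x ≡ RootedTriple.b r) →
                     Displays T r → Separates T K (RootedTriple.c r)
displays⇒separates K⊆ab (S , S⊑T , a∈S , b∈S , c∉S) =
  S , S⊑T , (λ x∈K → [ (λ { refl → ∈-leafSet⁺ a∈S }) , (λ { refl → ∈-leafSet⁺ b∈S }) ]′ (K⊆ab x∈K))
    , c∉S ∘ ∈-leafSet⁻

hyperforest⇒nonempty : Hyperforest E A → i ∈ A → Nonempty (E i)
hyperforest⇒nonempty {E = E} {A = A} {i = i} hyperforest i∈A
  with 0<∣p∣⇒Nonempty (≤-trans (s≤s z≤n) (hyperforest ⁅i⁆⊆A (i , x∈⁅x⁆ i)))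
  where
  ⁅i⁆⊆A : ⁅ i ⁆ ⊆ A
  ⁅i⁆⊆A j∈⁅i⁆ = subst (_∈ A) (sym (x∈⁅y⁆⇒x≡y i j∈⁅i⁆)) i∈A
... | x , x∈⋃ with ∈-⋃⁻ ⁅ i ⁆ x∈⋃
...   | j , j∈⁅i⁆ , x∈Ej with x∈⁅y⁆⇒x≡y i j∈⁅i⁆
...     | refl = x , x∈Ej

_≟ₜ_ : DecidableEquality (Triple n)
triple a b c a<b b<c ≟ₜ triple a′ b′ c′ a′<b′ b′<c′ with a Fin.≟ a′ | b Fin.≟ b′ | c Fin.≟ c′
... | yes refl | yes refl | yes refl =
  yes (cong₂ (triple a b c) (Fin.<-irrelevant a<b a′<b′) (Fin.<-irrelevant b<c b′<c′))
... | no  a≢a′ | _        | _        = no λ { refl → a≢a′ refl }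
... | yes _    | no  b≢b′ | _        = no λ { refl → b≢b′ refl }
... | yes _    | yes _    | no  c≢c′ = no λ { refl → c≢c′ refl }

index-of-lookup : ∀ {A : Set} {xs : List A} → Unique xs → ∀ i (x∈xs : lookup xs i ∈ₗ xs) → Any.index x∈xs ≡ i
index-of-lookup {xs = x ∷ xs} _           zero    (here _)      = refl
index-of-lookup {xs = x ∷ xs} (x∉xs ∷ _) zero    (there x∈xs)  = ⊥-elim (All.lookup x∉xs x∈xs refl)
index-of-lookup {xs = x ∷ xs} (x∉xs ∷ _) (suc i) (here xᵢ≡x)   = ⊥-elim (All.lookup x∉xs (∈-lookup i) (sym xᵢ≡x))
index-of-lookup {xs = x ∷ xs} (_ ∷ xs!)  (suc i) (there xᵢ∈xs) = cong suc (index-of-lookup xs! i xᵢ∈xs)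

module _ (τ : List (Triple n)) (τ! : Unique τ) where

  private
    τ-sets : Fin (length τ) → Subset n
    τ-sets i = tripleSet (lookup τ i)

  chooseBy : (Fin (length τ) → Subset n) → Triple n → Fin 3
  chooseBy F s with any? (s ≟ₜ_) τ
  ... | yes s∈τ = outgroup s (F (Any.index s∈τ))
  ... | no  _   = zero

  chooseBy-lookup : ∀ F i → chooseBy F (lookup τ i) ≡ outgroup (lookup τ i) (F i)
  chooseBy-lookup F i with any? (lookup τ i ≟ₜ_) τ
  ... | yes s∈τ = cong (outgroup (lookup τ i) ∘ F) (index-of-lookup τ! i s∈τ)
  ... | no  s∉τ = ⊥-elim (s∉τ (∈-lookup i))

  chosen-incompatible : ∀ {M F} → Nonempty M → Tight τ-sets M → (∀ j → F j ⊆ τ-sets j) → Hyperforest F M →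
    (∀ j → ∣ F j ∣ ≤ 2) → ¬ Compatible (λ r → ∃ λ s → s ∈ₗ τ × r ≡ rootedOn s (chooseBy F s))
  chosen-incompatible {M} {F} M-nonempty sets-tight F⊆sets F-hyperforest ∣F∣≤2 (T , (T! , X⊆T) , displays) =
    connected-not-separable F-connected (hyperforest⇒nonempty F-hyperforest) outgroup∈⋃
      M-nonempty T T! (λ {x} _ → ∈-leafSet⁺ (X⊆T x)) separates
    where
    outgroupOf : Fin (length τ) → Fin n
    outgroupOf i = RootedTriple.c (rootedOn (lookup τ i) (outgroup (lookup τ i) (F i)))

    ⋃F⊆⋃sets : ⋃[ M ] F ⊆ ⋃[ M ] τ-sets
    ⋃F⊆⋃sets = ⋃-mono id (λ {j} _ → F⊆sets j)

    F-connected : Connected F M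
    F-connected = hypertree⇒connected F-hyperforest (≤-trans (p⊆q⇒∣p∣≤∣q∣ ⋃F⊆⋃sets) sets-tight)

    outgroup∈⋃ : ∀ {i} → i ∈ M → outgroupOf i ∈ ⋃[ M ] F
    outgroup∈⋃ {i} i∈M = p⊆q∧∣q∣≤∣p∣⇒q⊆p ⋃F⊆⋃sets (≤-trans sets-tight (F-hyperforest id M-nonempty))
                           (∈-⋃⁺ i∈M (outgroup∈tripleSet (lookup τ i) (outgroup (lookup τ i) (F i))))

    separates : ∀ {i} → i ∈ M → Separates T (F i) (outgroupOf i)
    separates {i} i∈M = displays⇒separates (outgroup-avoids (lookup τ i) (F⊆sets i) (∣F∣≤2 i))
      (subst (Displays T ∘ rootedOn (lookup τ i)) (chooseBy-lookup F i)
             (displays _ (lookup τ i , ∈-lookup i , refl)))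

  dense-not-flexible : Fin (length τ) → n ≤ suc (length τ) → ¬ PhyloFlexible τ
  dense-not-flexible i₀ n≤1+∣τ∣ flexible =
    ¬¬-minimal (λ M → Nonempty M × Tight τ-sets M) ∣_∣ ((i₀ , ∈⊤) , all-tight)
      λ (M , (M-nonempty , M-tight) , M-minimal) →
    hyperforest⇒¬¬pair-hyperforest
      (minimal-tight⇒hyperforest τ-sets (2≤∣tripleSet∣ ∘ lookup τ) M-nonempty (λ _ ne tight → M-minimal (ne , tight)))
      λ (F , F⊆sets , F-hyperforest , ∣F∣≤2) →
    chosen-incompatible M-nonempty M-tight F⊆sets F-hyperforest ∣F∣≤2 (flexible (chooseBy F))
    where
    all-tight : Tight τ-sets ⊤
    all-tight = ≤-trans (∣p∣≤n (⋃[ ⊤ ] τ-sets)) (subst (λ m → n ≤ suc m) (sym (∣⊤∣≡n (length τ))) n≤1+∣τ∣)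

corollary1 : (n : ℕ) (τ : List (Triple n)) → Unique τ → τ ≢ [] →
    PhyloFlexible τ → length τ ≤ n ∸ 2
corollary1 n []          _  τ≢[] _        = ⊥-elim (τ≢[] refl)
corollary1 n τ@(_ ∷ _) τ! _    flexible with length τ ≤? n ∸ 2
... | yes fits     = fits
... | no  too-long = ⊥-elim (dense-not-flexible τ τ! zero n≤1+∣τ∣ flexible)
  where
  n≤1+∣τ∣ : n ≤ suc (length τ)
  n≤1+∣τ∣ = ≤-trans (m≤n+m∸n n 2) (s≤s (≰⇒> too-long))
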